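{- Let $X$ be a set of jobs with pairwise distinct names and let $\mathbb{B}$ be an approximant in which no name occurs twice, such that $\mathrm{fn}(\mathbb{B})\setminus\mathrm{names}(X)=\{\alpha\}$. Then $\mathbb{B}_X\{\alpha\leftarrow\langle\cdot\rangle\}$ is an external context.
   Context: Terms $t ::= x\mid\lambda x.t\mid t\,t$. Stacks $S ::= \epsilon\mid t:S$; $\langle t\mid\epsilon\rangle:=t$, $\langle t\mid u:S\rangle:=\langle t\,u\mid S\rangle$. A job is $(t,S)_\alpha$, with $\mathrm{rb}((t,S)_\alpha):=\langle t\mid S\rangle$; $\mathrm{names}(X)$ is the set of names of the jobs in $X$. Named multi-contexts $\mathbb{C} ::= x\mid\langle\cdot\rangle_\alpha\mid\lambda x.\mathbb{C}\mid\mathbb{C}\,\mathbb{C}$; $\mathrm{fn}(\mathbb{C})$ its names; $\mathbb{C}\{\alpha\leftarrow\mathbb{C}'\}$ capture-allowing replacement of $\langle\cdot\rangle_\alpha$ by $\mathbb{C}'$ (here $\langle\cdot\rangle$ denotes the ordinary unnamed context hole). For $X=\{j_{\alpha_1},\dots,j_{\alpha_n}\}$, $\mathbb{C}_X:=\mathbb{C}\{\alpha_1\leftarrow\mathrm{rb}(j_{\alpha_1})\}\cdots\{\alpha_n\leftarrow\mathrm{rb}(j_{\alpha_n})\}$. Approximants $\mathbb{B} ::= \langle\cdot\rangle_\alpha\mid\mathbb{R}\mid\lambda x.\mathbb{B}$, rigid approximants $\mathbb{R} ::= x\mid\mathbb{R}\,\mathbb{B}$. Rigid terms $r ::= x\mid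 r\,t$; rigid contexts $S ::= \langle\cdot\rangle\mid r\,B\mid S\,t$; external contexts $B ::= S\mid\lambda x.B$. -}

module Defs where

open import Data.Nat using (ℕ; _≟_)
open import Data.List using (List; []; _∷_; _++_; map; foldr)
open import Relation.Nullary using (yes; no)

Var : Set
Var = ℕ

Name : Set
Name = ℕ

data Term : Set where
  var : Var → Term
  lam : Var → Term → Term
  app : Term → Term → Term

Stack : Set
Stack = List Term

⟨_∣_⟩ : Term → Stack → Term
⟨ t ∣ [] ⟩ = t
⟨ t ∣ u ∷ S ⟩ = ⟨ app t u ∣ S ⟩

record Job : Set where
  constructor job
  field
    tm    : Term
    stack : Stack
    name  : Name
open Job public

rb : Job → Term
rb j = ⟨ tm j ∣ stack j ⟩

names : List Job → List Name
names X = map name X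

-- General syntax of terms with holes: named holes ⟨·⟩_α and unnamed hole ⟨·⟩.
-- Named multi-contexts are the elements without unnamed holes; (unnamed)
-- contexts are singled out by the predicates below.
data Ctx : Set where
  var  : Var → Ctx
  nh   : Name → Ctx
  hole : Ctx
  lam  : Var → Ctx → Ctx
  app  : Ctx → Ctx → Ctx

⌜_⌝ : Term → Ctx
⌜ var x ⌝ = var x
⌜ lam x t ⌝ = lam x ⌜ t ⌝
⌜ app t u ⌝ = app ⌜ t ⌝ ⌜ u ⌝

data IsMC : Ctx → Set where
  var : ∀ x → IsMC (var x)
  nh  : ∀ α → IsMC (nh α)
  lam : ∀ x {C} → IsMC C → IsMC (lam x C)
  app : ∀ {C D} → IsMC C → IsMC D → IsMC (app C D)

-- fn(C): names occurring in C, listed with multiplicity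
fn : Ctx → List Name
fn (var x) = []
fn (nh α) = α ∷ []
fn hole = []
fn (lam x C) = fn C
fn (app C D) = fn C ++ fn D

-- capture-allowing replacement  C{α ← D}
_⟪_≔_⟫ : Ctx → Name → Ctx → Ctx
var x ⟪ α ≔ D ⟫ = var x
nh β ⟪ α ≔ D ⟫ with β ≟ α
... | yes _ = D
... | no  _ = nh β
hole ⟪ α ≔ D ⟫ = hole
lam x C ⟪ α ≔ D ⟫ = lam x (C ⟪ α ≔ D ⟫)
app C C′ ⟪ α ≔ D ⟫ = app (C ⟪ α ≔ D ⟫) (C′ ⟪ α ≔ D ⟫)

_[_] : Ctx → List Job → Ctx
C [ [] ] = C
C [ j ∷ X ] = (C ⟪ name j ≔ ⌜ rb j ⌝ ⟫) [ X ]

mutual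
  data Approx : Ctx → Set where
    nh    : ∀ α → Approx (nh α)
    rigid : ∀ {R} → RigidApprox R → Approx R
    lam   : ∀ x {B} → Approx B → Approx (lam x B)

  data RigidApprox : Ctx → Set where
    var : ∀ x → RigidApprox (var x)
    app : ∀ {R B} → RigidApprox R → Approx B → RigidApprox (app R B)

data RigidTm : Term → Set where
  var : ∀ x → RigidTm (var x)
  app : ∀ {r} t → RigidTm r → RigidTm (app r t)

mutual
  data RigidCtx : Ctx → Set where
    hole : RigidCtx hole
    rapp : ∀ {r B} → RigidTm r → ExtCtx B → RigidCtx (app ⌜ r ⌝ B)
    appt : ∀ {S} → RigidCtx S → (t : Term) → RigidCtx (app S ⌜ t ⌝)

  data ExtCtx : Ctx → Set where
    rigid : ∀ {S} → RigidCtx S → ExtCtx S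
    lam   : ∀ x {B} → ExtCtx B → ExtCtx (lam x B)

-- Since the names of 𝔹 are unique, at an application ℝ 𝔹′ the
-- name α lies in exactly one of the two sides; every name of the other side is the name of a job,
-- so that side becomes a term under the substitution (a rigid term if it is ℝ), which replacing α
-- leaves unchanged. Hence α ∈ ℝ yields a rigid context S t and α ∈ 𝔹′ yields r B.
module Submission where

open import Defs
open import Data.Empty using (⊥-elim)
open import Data.List using (List; []; _∷_; _++_)
open import Data.List.Membership.Propositional using (_∈_; _∉_)
open import Data.List.Membership.Propositional.Properties using (∈-++⁻)
open import Data.List.Relation.Binary.Disjoint.Propositional using (Disjoint)
open import Data.List.Relation.Binary.Subset.Propositional using (_⊆_)
open import Data.List.Relation.Binary.Subset.Propositional.Properties
  using (⊆-trans; xs⊆xs++ys; xs⊆ys++xs; ⊆∷∧∉⇒⊆)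
open import Data.List.Relation.Unary.All using (lookup)
import Data.List.Relation.Unary.All.Properties as All
open import Data.List.Relation.Unary.AllPairs using ([]; _∷_)
open import Data.List.Relation.Unary.Any using (here; there)
open import Data.List.Relation.Unary.Unique.Propositional using (Unique)
open import Data.Nat using (_≟_)
open import Data.List.Membership.DecPropositional _≟_ using (_∈?_)
open import Data.Product using (_×_; _,_; ∃)
open import Data.Sum using (inj₁; inj₂)
open import Function.Bundles using (_⇔_; Equivalence)
open import Relation.Binary.PropositionalEquality
  using (_≡_; refl; sym; trans; cong; cong₂; subst)
open import Relation.Nullary using (yes; no)

Unique-++⁻ : ∀ xs {ys : List Name} → Unique (xs ++ ys) → Unique xs × Unique ys × Disjoint xs ys
Unique-++⁻ []       u        = [] , u , λ ()
Unique-++⁻ (x ∷ xs) (x∉ ∷ u) with Unique-++⁻ xs u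
... | uxs , uys , xs#ys = All.++⁻ˡ xs x∉ ∷ uxs , uys , λ where
  (here refl , x∈ys) → lookup (All.++⁻ʳ xs x∉) x∈ys refl
  (there v∈xs , v∈ys) → xs#ys (v∈xs , v∈ys)

⊆-++⁻ˡ : ∀ (xs : List Name) {ys zs} → xs ++ ys ⊆ zs → xs ⊆ zs
⊆-++⁻ˡ xs {ys} = ⊆-trans (xs⊆xs++ys xs ys)

⊆-++⁻ʳ : ∀ (xs : List Name) {ys zs} → xs ++ ys ⊆ zs → ys ⊆ zs
⊆-++⁻ʳ xs {ys} = ⊆-trans (xs⊆ys++xs ys xs)

[]-var : ∀ X x → var x [ X ] ≡ var x
[]-var []      x = refl
[]-var (j ∷ X) x = []-var X x

[]-lam : ∀ X x C → lam x C [ X ] ≡ lam x (C [ X ])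
[]-lam []      x C = refl
[]-lam (j ∷ X) x C = []-lam X x _

[]-app : ∀ X C D → app C D [ X ] ≡ app (C [ X ]) (D [ X ])
[]-app []      C D = refl
[]-app (j ∷ X) C D = []-app X _ _

⌜⌝-⟪≔⟫ : ∀ t α D → ⌜ t ⌝ ⟪ α ≔ D ⟫ ≡ ⌜ t ⌝
⌜⌝-⟪≔⟫ (var x)   α D = refl
⌜⌝-⟪≔⟫ (lam x t) α D = cong (lam x) (⌜⌝-⟪≔⟫ t α D)
⌜⌝-⟪≔⟫ (app t u) α D = cong₂ app (⌜⌝-⟪≔⟫ t α D) (⌜⌝-⟪≔⟫ u α D)

⌜⌝-[] : ∀ X t → ⌜ t ⌝ [ X ] ≡ ⌜ t ⌝
⌜⌝-[] []      t = refl
⌜⌝-[] (j ∷ X) t = trans (cong (_[ X ]) (⌜⌝-⟪≔⟫ t _ _)) (⌜⌝-[] X t)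

nh-⟪≔⟫-self : ∀ α D → nh α ⟪ α ≔ D ⟫ ≡ D
nh-⟪≔⟫-self α D with α ≟ α
... | yes _ = refl
... | no α≢α = ⊥-elim (α≢α refl)

nh-[]-∈ : ∀ X {β} → β ∈ names X → ∃ λ t → nh β [ X ] ≡ ⌜ t ⌝
nh-[]-∈ (j ∷ X) {β} β∈ with β ≟ name j | β∈
... | yes _ | _          = rb j , ⌜⌝-[] X (rb j)
... | no β≢ | here β≡    = ⊥-elim (β≢ β≡)
... | no _  | there β∈X = nh-[]-∈ X β∈X

nh-[]-∉ : ∀ X {β} → β ∉ names X → nh β [ X ] ≡ nh β
nh-[]-∉ []      β∉ = refl
nh-[]-∉ (j ∷ X) {β} β∉ with β ≟ name j
... | yes β≡ = ⊥-elim (β∉ (here β≡))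
... | no _   = nh-[]-∉ X (λ β∈X → β∉ (there β∈X))

module _ (X : List Job) where

  mutual
    Approx⇒Term : ∀ {B} → Approx B → fn B ⊆ names X → ∃ λ t → B [ X ] ≡ ⌜ t ⌝
    Approx⇒Term (nh α)    fn⊆ = nh-[]-∈ X (fn⊆ (here refl))
    Approx⇒Term (rigid R) fn⊆ with RigidApprox⇒RigidTm R fn⊆
    ... | r , _ , R[X]≡r = r , R[X]≡r
    Approx⇒Term (lam x {B} a) fn⊆ with Approx⇒Term a fn⊆
    ... | t , B[X]≡t = lam x t , trans ([]-lam X x B) (cong (lam x) B[X]≡t)

    RigidApprox⇒RigidTm : ∀ {R} → RigidApprox R → fn R ⊆ names X →
      ∃ λ r → RigidTm r × R [ X ] ≡ ⌜ r ⌝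
    RigidApprox⇒RigidTm (var x) _ = var x , var x , []-var X x
    RigidApprox⇒RigidTm (app {R} {B} ρ a) fn⊆
      with RigidApprox⇒RigidTm ρ (⊆-++⁻ˡ (fn R) fn⊆)
         | Approx⇒Term a (⊆-++⁻ʳ (fn R) fn⊆)
    ... | r , rigid-r , R[X]≡r | t , B[X]≡t =
      app r t , app t rigid-r , trans ([]-app X R B) (cong₂ app R[X]≡r B[X]≡t)

  module _ (α : Name) (α∉X : α ∉ names X) where

    filled-⟪≔hole⟫ : ∀ {C t} → C [ X ] ≡ ⌜ t ⌝ → (C [ X ]) ⟪ α ≔ hole ⟫ ≡ ⌜ t ⌝
    filled-⟪≔hole⟫ {t = t} C[X]≡t = trans (cong _⟪ α ≔ hole ⟫ C[X]≡t) (⌜⌝-⟪≔⟫ t α hole)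

    mutual
      Approx⇒ExtCtx : ∀ {B} → Approx B → Unique (fn B) → α ∈ fn B → fn B ⊆ α ∷ names X →
        ExtCtx ((B [ X ]) ⟪ α ≔ hole ⟫)
      Approx⇒ExtCtx (nh .α) _ (here refl) _
        rewrite nh-[]-∉ X α∉X | nh-⟪≔⟫-self α hole = rigid hole
      Approx⇒ExtCtx (rigid R) u α∈ fn⊆ = rigid (RigidApprox⇒RigidCtx R u α∈ fn⊆)
      Approx⇒ExtCtx (lam x {B} a) u α∈ fn⊆
        rewrite []-lam X x B = lam x (Approx⇒ExtCtx a u α∈ fn⊆)

      RigidApprox⇒RigidCtx : ∀ {R} → RigidApprox R → Unique (fn R) → α ∈ fn R →
        fn R ⊆ α ∷ names X → RigidCtx ((R [ X ]) ⟪ α ≔ hole ⟫)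
      RigidApprox⇒RigidCtx (app {R} {B} ρ a) u α∈ fn⊆ rewrite []-app X R B
        with Unique-++⁻ (fn R) u | ∈-++⁻ (fn R) α∈
      ... | uR , _ , R#B | inj₁ α∈R
        with Approx⇒Term a (⊆∷∧∉⇒⊆ (⊆-++⁻ʳ (fn R) fn⊆) (λ α∈B → R#B (α∈R , α∈B)))
      ... | t , B[X]≡t =
        subst RigidCtx (cong (app _) (sym (filled-⟪≔hole⟫ B[X]≡t)))
          (appt (RigidApprox⇒RigidCtx ρ uR α∈R (⊆-++⁻ˡ (fn R) fn⊆)) t)
      RigidApprox⇒RigidCtx (app {R} {B} ρ a) u α∈ fn⊆ | _ , uB , R#B | inj₂ α∈B
        with RigidApprox⇒RigidTm ρ (⊆∷∧∉⇒⊆ (⊆-++⁻ˡ (fn R) fn⊆) (λ α∈R → R#B (α∈R , α∈B)))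
      ... | r , rigid-r , R[X]≡r =
        subst RigidCtx (cong (λ C → app C _) (sym (filled-⟪≔hole⟫ R[X]≡r)))
          (rapp rigid-r (Approx⇒ExtCtx a uB α∈B (⊆-++⁻ʳ (fn R) fn⊆)))

lemma5 : (X : List Job) (B : Ctx) (α : Name)
    → Unique (names X)
    → Approx B
    → Unique (fn B)
    → (∀ β → ((β ∈ fn B) × (β ∉ names X)) ⇔ (β ≡ α))
    → ExtCtx ((B [ X ]) ⟪ α ≔ hole ⟫)
lemma5 X B α _ a u fn∖X≡α with Equivalence.from (fn∖X≡α α) refl
... | α∈B , α∉X = Approx⇒ExtCtx X α α∉X a u α∈B fn⊆
  where
    fn⊆ : fn B ⊆ α ∷ names X
    fn⊆ {β} β∈B with β ∈? names X
    ... | yes β∈X = there β∈X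
    ... | no β∉X  = here (Equivalence.to (fn∖X≡α β) (β∈B , β∉X))
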